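{- Let $n \ge 2$ and $\sigma \ge 2$, let $s$ be a random string of length $n$ with characters drawn independently and uniformly from an alphabet of size $\sigma$, and let $k$ be the number of tokens of $\mathcal{F}(s)$. Set $p = (\sigma-1)/\sigma$, $m = n-1$ and $q = 1-2p = (2-\sigma)/\sigma$ (with the convention $0^0 = 1$). Then \[ \mathrm{Var}[k] = \frac{mp(1-p)}{4} - \frac{mp(1-p)\,q^{m-1}}{2} + \frac{1 - q^{2m}}{16}. \] In particular $\mathrm{Var}[k] = 0$ when $n = 2$, and for large $n$, $\mathrm{Var}[k] \approx (n-1)(\sigma-1)/(4\sigma^2)$.
   Context: Let $\texttt{@}$ and $\texttt{\$}$ be two distinct symbols not in the alphabet. For a string $s$ let $\hat{s} = \texttt{@}\,s\,\texttt{\$}$. The leading (resp. trailing) run of a non-empty string is its longest prefix (resp. suffix) consisting of a single repeated symbol. The Flashback decomposition $\mathcal{F}(s)$ is a list of tokens produced starting with active span $\hat{s}$: (i) if the span is empty, stop; (ii) let $\ell$ be its leading run length; if $\ell$ equals the span length, append (span, $0$) and stop; (iii) otherwise let $\sigma'$ be the leading run followed by the trailing run and the middle the span with both removed; if the middle is empty append $(\sigma',0)$ and stop, else append $(\sigma',\ell)$ and continue on the middle. -}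

module Defs where

open import Data.Nat as ℕ using (ℕ; zero; suc; _≤_)
open import Data.Nat.Properties as ℕP using ()
open import Data.Fin using (Fin)
import Data.Fin.Properties as FinP
open import Data.List using (List; []; _∷_; length; reverse; takeWhile; drop; map; concatMap; allFin; _++_; foldr)
open import Data.Product using (_×_; _,_)
open import Data.Bool using (Bool; true; false)
open import Relation.Nullary using (Dec; yes; no; does)
open import Relation.Binary.PropositionalEquality using (_≡_; refl)
open import Data.Integer as ℤ using (ℤ; +_)
open import Data.Rational as ℚ using (ℚ; 0ℚ; 1ℚ)

-- Symbols of the extended string  ŝ = @ s $  over the alphabet Fin σ

data Sym (σ : ℕ) : Set where
  at     : Sym σ
  dollar : Sym σ
  chr    : Fin σ → Sym σ

_≟S_ : ∀ {σ} (a b : Sym σ) → Dec (a ≡ b)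
at ≟S at = yes refl
at ≟S dollar = no (λ ())
at ≟S chr _ = no (λ ())
dollar ≟S at = no (λ ())
dollar ≟S dollar = yes refl
dollar ≟S chr _ = no (λ ())
chr _ ≟S at = no (λ ())
chr _ ≟S dollar = no (λ ())
chr x ≟S chr y with x FinP.≟ y
... | yes refl = yes refl
... | no x≢y = no (λ { refl → x≢y refl })

hat : ∀ {σ} → List (Fin σ) → List (Sym σ)
hat s = at ∷ map chr s ++ dollar ∷ []

leadingRun : ∀ {σ} → List (Sym σ) → List (Sym σ)
leadingRun [] = []
leadingRun (a ∷ xs) = a ∷ takeWhile (λ b → b ≟S a) xs

trailingRun : ∀ {σ} → List (Sym σ) → List (Sym σ)
trailingRun xs = reverse (leadingRun (reverse xs))

dropLast : ∀ {A : Set} → ℕ → List A → List A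
dropLast k xs = reverse (drop k (reverse xs))

Token : ℕ → Set
Token σ = List (Sym σ) × ℕ

-- The fuel argument only serves
-- termination: each non-final step removes at least two symbols from the
-- span, so fuel = length of the span is always sufficient.
flashbackGo : ∀ {σ} → ℕ → List (Sym σ) → List (Token σ)
flashbackGo zero _ = []
flashbackGo (suc f) [] = []
flashbackGo (suc f) span@(_ ∷ _) with ℕ._≟_ (length (leadingRun span)) (length span)
... | yes _ = (span , 0) ∷ []
... | no _ with dropLast (length (trailingRun span)) (drop (length (leadingRun span)) span)
...   | [] = (leadingRun span ++ trailingRun span , 0) ∷ []
...   | mid@(_ ∷ _) = (leadingRun span ++ trailingRun span , length (leadingRun span))
                      ∷ flashbackGo f mid

flashback : ∀ {σ} → List (Fin σ) → List (Token σ)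
flashback s = flashbackGo (length (hat s)) (hat s)

numTokens : ∀ {σ} → List (Fin σ) → ℕ
numTokens s = length (flashback s)

allStrings : (σ n : ℕ) → List (List (Fin σ))
allStrings σ zero = [] ∷ []
allStrings σ (suc n) = concatMap (λ s → map (_∷ s) (allFin σ)) (allStrings σ n)

sumℚ : List ℚ → ℚ
sumℚ = foldr ℚ._+_ 0ℚ

-- division of a rational by a natural number (only used with d = σ^n ≥ 1 or σ ≥ 2)
_÷ℕ_ : ℚ → ℕ → ℚ
q ÷ℕ zero = 0ℚ
q ÷ℕ suc d = q ℚ.* (+ 1 ℚ./ suc d)

-- natural number powers of a rational, with q ^ 0 = 1 (so 0 ^ 0 = 1)
_^ℚ_ : ℚ → ℕ → ℚ
q ^ℚ zero = 1ℚ
q ^ℚ suc k = q ℚ.* (q ^ℚ k)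

expect : (σ n : ℕ) → (List (Fin σ) → ℚ) → ℚ
expect σ n f = sumℚ (map f (allStrings σ n)) ÷ℕ (σ ℕ.^ n)

variance : (σ n : ℕ) → (List (Fin σ) → ℚ) → ℚ
variance σ n f = expect σ n (λ s → f s ℚ.* f s) ℚ.- (expect σ n f ℚ.* expect σ n f)

ℕtoℚ : ℕ → ℚ
ℕtoℚ k = + k ℚ./ 1

{-# OPTIONS --safe #-}

-- Every non-final step of the Flashback loop strips the leading and the trailing run off the
-- span and the final step takes the remaining one or two runs, so a span with r runs yields
-- ⌈r/2⌉ tokens. Since ŝ has two runs more than s, a string of length n ≥ 1 whose adjacent
-- characters differ at X of the n − 1 positions has k = 2 + ⌊X/2⌋ tokens. For a uniform string
-- the n − 1 events "adjacent characters differ" are independent of probability p, so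
-- X ~ Bin(m, p). As 2 + ⌊x/2⌋ = 7/4 + x/2 + (−1)^x/4, both k and k² have the form
-- a + bX + cX² + (−1)^X (d + eX); this class is invariant under X ↦ X + 1, so conditioning on
-- the first trial computes their binomial expectations by induction on m.

module Submission where

open import Defs
open import Data.Nat using (ℕ; _≤_; _∸_)
open import Data.Integer using (+_) renaming (_-_ to _-ℤ_)
open import Data.Rational using (ℚ; _+_; _-_; _*_; _/_; 1ℚ)
open import Relation.Binary.PropositionalEquality using (_≡_)

open import Data.Nat as ℕ using (zero; suc; s≤s; ⌊_/2⌋; ⌈_/2⌉)
open import Data.Nat.Properties using (m+1+n≢m; ≤-refl; ≤-trans; m≤m+n; m≤n+m; +-identityʳ; module ≤-Reasoning)
open import Data.Fin as Fin using (Fin)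
open import Data.Fin.Properties using (suc-injective)
open import Data.Integer as ℤ using (ℤ)
import Data.Integer.Properties as ℤP
open import Data.Rational as ℚ using (0ℚ; ½; -_; toℚᵘ)
open import Data.Rational.Properties
  using (toℚᵘ-injective; toℚᵘ-fromℚᵘ; toℚᵘ-homo-+; toℚᵘ-homo-*; toℚᵘ-homo‿-; 1≢0; +-*-commutativeRing;
         +-identityˡ; +-assoc; *-identityˡ; *-identityʳ; *-assoc; *-zeroˡ; *-zeroʳ; *-distribˡ-+; *-distribʳ-+)
open import Data.Rational.Unnormalised as ℚᵘ using (mkℚᵘ; *≡*)
import Data.Rational.Unnormalised.Properties as ℚᵘP
open import Data.List using (List; []; _∷_; _++_; _∷ʳ_; length; map; concatMap; allFin; drop; reverse; replicate; head; last; takeWhile)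
open import Data.List.Properties
  using (∷-injectiveˡ; length-++; length-++-sucʳ; length-reverse; ++-assoc; ++-identityʳ;
         unfold-reverse; reverse-++; reverse-involutive; map-∘; map-tabulate)
open import Data.Maybe using (just)
open import Data.Maybe.Properties using (just-injective)
open import Data.Bool using (if_then_else_)
open import Data.Product using (∃-syntax; _×_; _,_)
open import Function using (_∘_; id)
open import Relation.Nullary using (yes; no; does; contradiction)
open import Relation.Nullary.Decidable using (dec⇒maybe)
open import Relation.Binary.PropositionalEquality using (_≢_; refl; sym; trans; cong; cong₂; subst; module ≡-Reasoning)
open import Tactic.RingSolver using (solve-∀)
open import Tactic.RingSolver.Core.AlmostCommutativeRing using (AlmostCommutativeRing; fromCommutativeRing)

private variable
  A : Set
  σ : ℕ

drop-length-++ : ∀ (xs ys : List A) → drop (length xs) (xs ++ ys) ≡ ys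
drop-length-++ []       ys = refl
drop-length-++ (x ∷ xs) ys = drop-length-++ xs ys

dropLast-length-++ : ∀ (xs ys : List A) → dropLast (length ys) (xs ++ ys) ≡ xs
dropLast-length-++ xs ys = begin
  reverse (drop (length ys) (reverse (xs ++ ys)))
    ≡⟨ cong (reverse ∘ drop (length ys)) (reverse-++ xs ys) ⟩
  reverse (drop (length ys) (reverse ys ++ reverse xs))
    ≡⟨ cong (λ n → reverse (drop n (reverse ys ++ reverse xs))) (length-reverse ys) ⟨
  reverse (drop (length (reverse ys)) (reverse ys ++ reverse xs))
    ≡⟨ cong reverse (drop-length-++ (reverse ys) (reverse xs)) ⟩
  reverse (reverse xs)
    ≡⟨ reverse-involutive xs ⟩
  xs ∎
  where open ≡-Reasoning

length≤-infix : ∀ (xs ys zs : List A) → length ys ≤ length (xs ++ ys ++ zs)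
length≤-infix xs ys zs = begin
  length ys                        ≤⟨ m≤m+n (length ys) (length zs) ⟩
  length ys ℕ.+ length zs          ≡⟨ length-++ ys ⟨
  length (ys ++ zs)                ≤⟨ m≤n+m (length (ys ++ zs)) (length xs) ⟩
  length xs ℕ.+ length (ys ++ zs)  ≡⟨ length-++ xs ⟨
  length (xs ++ ys ++ zs)          ∎
  where open ≤-Reasoning

replicate-∷ʳ : ∀ n (x : A) → replicate n x ∷ʳ x ≡ x ∷ replicate n x
replicate-∷ʳ zero    x = refl
replicate-∷ʳ (suc n) x = cong (x ∷_) (replicate-∷ʳ n x)

reverse-replicate : ∀ n (x : A) → reverse (replicate n x) ≡ replicate n x
reverse-replicate zero    x = refl
reverse-replicate (suc n) x = begin
  reverse (x ∷ replicate n x)   ≡⟨ unfold-reverse x (replicate n x) ⟩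
  reverse (replicate n x) ∷ʳ x  ≡⟨ cong (_∷ʳ x) (reverse-replicate n x) ⟩
  replicate n x ∷ʳ x            ≡⟨ replicate-∷ʳ n x ⟩
  x ∷ replicate n x             ∎
  where open ≡-Reasoning

head-++ : ∀ (xs ys : List A) {a} → head xs ≡ just a → head (xs ++ ys) ≡ just a
head-++ (x ∷ xs) ys eq = eq

last-++-∷ : ∀ (xs : List A) y ys → last (xs ++ y ∷ ys) ≡ last (y ∷ ys)
last-++-∷ []            y ys = refl
last-++-∷ (x ∷ [])      y ys = refl
last-++-∷ (x ∷ x′ ∷ xs) y ys = last-++-∷ (x′ ∷ xs) y ys

last-∷ʳ : ∀ (xs : List A) x → last (xs ∷ʳ x) ≡ just x
last-∷ʳ xs x = last-++-∷ xs x []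

last-replicate : ∀ i (x : A) → last (replicate (suc i) x) ≡ just x
last-replicate i x = trans (cong last (sym (replicate-∷ʳ i x))) (last-∷ʳ (replicate i x) x)

head-reverse : ∀ (xs : List A) → head (reverse xs) ≡ last xs
head-reverse xs = trans (sym (last-reverse (reverse xs))) (cong last (reverse-involutive xs))
  where
  last-reverse : ∀ (ys : List A) → last (reverse ys) ≡ head ys
  last-reverse []       = refl
  last-reverse (y ∷ ys) = trans (cong last (unfold-reverse y ys)) (last-∷ʳ (reverse ys) y)

-- Runs

runs : List (Sym σ) → ℕ
runs []               = 0
runs (x ∷ [])         = 1
runs (x ∷ xs@(y ∷ _)) = if does (x ≟S y) then runs xs else suc (runs xs)

runsOf : List (Fin σ) → ℕ
runsOf s = runs (map chr s)

runs-∷-≡ : ∀ (x : Sym σ) xs → runs (x ∷ x ∷ xs) ≡ runs (x ∷ xs)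
runs-∷-≡ x xs with x ≟S x
... | yes _   = refl
... | no x≢x = contradiction refl x≢x

runs-∷-≢ : ∀ {x y : Sym σ} ys → x ≢ y → runs (x ∷ y ∷ ys) ≡ suc (runs (y ∷ ys))
runs-∷-≢ {x = x} {y} ys x≢y with x ≟S y
... | yes x≡y = contradiction x≡y x≢y
... | no _    = refl

runs-replicate-++ : ∀ {x : Sym σ} i ys → head ys ≢ just x →
                    runs (replicate (suc i) x ++ ys) ≡ suc (runs ys)
runs-replicate-++         zero    []       _   = refl
runs-replicate-++         zero    (y ∷ ys) y≢x = runs-∷-≢ ys (y≢x ∘ cong just ∘ sym)
runs-replicate-++ {x = x} (suc i) ys       ¬hd =
  trans (runs-∷-≡ x (replicate i x ++ ys)) (runs-replicate-++ i ys ¬hd)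

runs-replicate : ∀ (x : Sym σ) i → runs (replicate (suc i) x) ≡ 1
runs-replicate x i =
  trans (cong runs (sym (++-identityʳ (replicate (suc i) x)))) (runs-replicate-++ i [] λ ())

runs-++-replicate : ∀ {z : Sym σ} xs j → last xs ≢ just z →
                    runs (xs ++ replicate (suc j) z) ≡ suc (runs xs)
runs-++-replicate {z = z} []       j _   = runs-replicate z j
runs-++-replicate {z = z} (y ∷ []) j y≢z =
  trans (runs-∷-≢ (replicate j z) (y≢z ∘ cong just)) (cong suc (runs-replicate z j))
runs-++-replicate (y ∷ y′ ∷ xs) j ¬last with y ≟S y′ | runs-++-replicate (y′ ∷ xs) j ¬last
... | yes _ | eq = eq
... | no _  | eq = cong suc eq

takeWhile-replicate-++ : ∀ {x : Sym σ} i ys → head ys ≢ just x →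
                         takeWhile (_≟S x) (replicate i x ++ ys) ≡ replicate i x
takeWhile-replicate-++         zero    []       _   = refl
takeWhile-replicate-++ {x = x} zero    (y ∷ ys) y≢x with y ≟S x
... | yes y≡x = contradiction (cong just y≡x) y≢x
... | no _    = refl
takeWhile-replicate-++ {x = x} (suc i) ys       ¬hd with x ≟S x
... | yes _   = cong (x ∷_) (takeWhile-replicate-++ i ys ¬hd)
... | no x≢x = contradiction refl x≢x

leadingRun-replicate-++ : ∀ {x : Sym σ} i ys → head ys ≢ just x →
                          leadingRun (replicate (suc i) x ++ ys) ≡ replicate (suc i) x
leadingRun-replicate-++ {x = x} i ys ¬hd = cong (x ∷_) (takeWhile-replicate-++ i ys ¬hd)

leadingRun-replicate : ∀ (x : Sym σ) i → leadingRun (replicate (suc i) x) ≡ replicate (suc i) x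
leadingRun-replicate x i =
  trans (cong leadingRun (sym (++-identityʳ (replicate (suc i) x)))) (leadingRun-replicate-++ i [] λ ())

trailingRun-++-replicate : ∀ {z : Sym σ} xs j → last xs ≢ just z →
                           trailingRun (xs ++ replicate (suc j) z) ≡ replicate (suc j) z
trailingRun-++-replicate {z = z} xs j ¬last = begin
  reverse (leadingRun (reverse (xs ++ Z)))
    ≡⟨ cong (reverse ∘ leadingRun) (reverse-++ xs Z) ⟩
  reverse (leadingRun (reverse Z ++ reverse xs))
    ≡⟨ cong (λ r → reverse (leadingRun (r ++ reverse xs))) (reverse-replicate (suc j) z) ⟩
  reverse (leadingRun (Z ++ reverse xs))
    ≡⟨ cong reverse (leadingRun-replicate-++ j (reverse xs) (¬last ∘ trans (sym (head-reverse xs)))) ⟩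
  reverse Z
    ≡⟨ reverse-replicate (suc j) z ⟩
  Z ∎
  where
  open ≡-Reasoning
  Z = replicate (suc j) z

middle : List (Sym σ) → List (Sym σ)
middle span = dropLast (length (trailingRun span)) (drop (length (leadingRun span)) span)

module _ {x z : Sym σ} (i j : ℕ) (mid : List (Sym σ))
         (¬head : head (mid ++ replicate (suc j) z) ≢ just x)
         (¬last : last (replicate (suc i) x ++ mid) ≢ just z) where

  private
    X Z : List (Sym σ)
    X = replicate (suc i) x
    Z = replicate (suc j) z

  leadingRun-outer : leadingRun (X ++ mid ++ Z) ≡ X
  leadingRun-outer = leadingRun-replicate-++ i (mid ++ Z) ¬head

  trailingRun-outer : trailingRun (X ++ mid ++ Z) ≡ Z
  trailingRun-outer = trans (cong trailingRun (sym (++-assoc X mid Z))) (trailingRun-++-replicate (X ++ mid) j ¬last)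

  middle-outer : middle (X ++ mid ++ Z) ≡ mid
  middle-outer = begin
    dropLast (length (trailingRun span)) (drop (length (leadingRun span)) span)
      ≡⟨ cong₂ (λ T L → dropLast (length T) (drop (length L) span)) trailingRun-outer leadingRun-outer ⟩
    dropLast (length Z) (drop (length X) span)
      ≡⟨ cong (dropLast (length Z)) (drop-length-++ X (mid ++ Z)) ⟩
    dropLast (length Z) (mid ++ Z)
      ≡⟨ dropLast-length-++ mid Z ⟩
    mid ∎
    where
    open ≡-Reasoning
    span = X ++ mid ++ Z

  length-leadingRun-outer≢ : length (leadingRun (X ++ mid ++ Z)) ≢ length (X ++ mid ++ Z)
  length-leadingRun-outer≢ ℓ≡ = m+1+n≢m (length X) (sym (begin
    length X                                          ≡⟨ cong length leadingRun-outer ⟨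
    length (leadingRun (X ++ mid ++ Z))               ≡⟨ ℓ≡ ⟩
    length (X ++ mid ++ Z)                            ≡⟨ length-++ X ⟩
    length X ℕ.+ length (mid ++ Z)                    ≡⟨ cong (length X ℕ.+_) (length-++-sucʳ mid z (replicate j z)) ⟩
    length X ℕ.+ suc (length (mid ++ replicate j z))  ∎))
    where open ≡-Reasoning

  runs-outer : runs (X ++ mid ++ Z) ≡ 2 ℕ.+ runs mid
  runs-outer = begin
    runs (X ++ mid ++ Z)    ≡⟨ cong runs (++-assoc X mid Z) ⟨
    runs ((X ++ mid) ++ Z)  ≡⟨ runs-++-replicate (X ++ mid) j ¬last ⟩
    suc (runs (X ++ mid))   ≡⟨ cong suc (runs-replicate-++ i mid (¬head ∘ head-++ mid Z)) ⟩
    2 ℕ.+ runs mid          ∎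
    where open ≡-Reasoning

data StartsWithRun {σ} (x : Sym σ) : List (Sym σ) → Set where
  run++ : ∀ i rest → head rest ≢ just x → StartsWithRun x (replicate (suc i) x ++ rest)

startsWithRun : ∀ (x : Sym σ) xs → StartsWithRun x (x ∷ xs)
startsWithRun x []       = run++ 0 [] λ ()
startsWithRun x (y ∷ ys) with y ≟S x
... | no y≢x  = run++ 0 (y ∷ ys) (y≢x ∘ just-injective)
... | yes refl with startsWithRun x ys
...   | run++ i rest ¬head = run++ (suc i) rest ¬head

endsWithRun : ∀ (y : Sym σ) ys →
              ∃[ xs ] ∃[ z ] ∃[ j ] (y ∷ ys ≡ xs ++ replicate (suc j) z × last xs ≢ just z)
endsWithRun y []        = [] , y , 0 , refl , λ ()
endsWithRun y (y′ ∷ ys) with endsWithRun y′ ys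
... | xs@(_ ∷ _) , z , j , eq , ¬last = y ∷ xs , z , j , cong (y ∷_) eq , ¬last
... | []         , z , j , eq , _ with y ≟S z
...   | yes refl = [] , y , suc j , cong (y ∷_) eq , λ ()
...   | no y≢z   = y ∷ [] , z , j , cong (y ∷_) eq , y≢z ∘ just-injective

data OuterRuns {σ} : List (Sym σ) → Set where
  singleRun : ∀ x i → OuterRuns (replicate (suc i) x)
  outerRuns : ∀ {x z} i j mid →
              head (mid ++ replicate (suc j) z) ≢ just x →
              last (replicate (suc i) x ++ mid) ≢ just z →
              OuterRuns (replicate (suc i) x ++ mid ++ replicate (suc j) z)

outerRuns? : ∀ (x : Sym σ) xs → OuterRuns (x ∷ xs)
outerRuns? x xs with startsWithRun x xs
... | run++ i [] _ = subst OuterRuns (sym (++-identityʳ (replicate (suc i) x))) (singleRun x i)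
... | run++ i (y ∷ ys) y≢x with endsWithRun y ys
...   | mid , z , j , eq , ¬last =
  subst (λ r → OuterRuns (replicate (suc i) x ++ r)) (sym eq)
        (outerRuns i j mid (subst (λ r → head r ≢ just x) eq y≢x) (¬last′ mid eq ¬last))
  where
  ¬last′ : ∀ mid → y ∷ ys ≡ mid ++ replicate (suc j) z → last mid ≢ just z →
           last (replicate (suc i) x ++ mid) ≢ just z
  ¬last′ (m ∷ ms) _  ¬last = ¬last ∘ trans (sym (last-++-∷ (replicate (suc i) x) m ms))
  ¬last′ []       eq _     last≡z = y≢x (cong just (begin
    y  ≡⟨ ∷-injectiveˡ eq ⟩
    z  ≡⟨ just-injective (trans (sym last≡z) (trans (cong last (++-identityʳ X)) (last-replicate i x))) ⟩
    x  ∎))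
    where
    open ≡-Reasoning
    X = replicate (suc i) x

-- The Flashback loop

flashbackGo-[] : ∀ f → flashbackGo {σ} f [] ≡ []
flashbackGo-[] zero    = refl
flashbackGo-[] (suc f) = refl

flashbackGo-singleRun : ∀ f (x : Sym σ) xs → length (leadingRun (x ∷ xs)) ≡ length (x ∷ xs) →
                        flashbackGo (suc f) (x ∷ xs) ≡ (x ∷ xs , 0) ∷ []
flashbackGo-singleRun f x xs ℓ≡ with length (leadingRun (x ∷ xs)) ℕ.≟ length (x ∷ xs)
... | yes _   = refl
... | no ℓ≢ = contradiction ℓ≡ ℓ≢

length-flashbackGo-step : ∀ f (x : Sym σ) xs → length (leadingRun (x ∷ xs)) ≢ length (x ∷ xs) →
                          length (flashbackGo (suc f) (x ∷ xs)) ≡ suc (length (flashbackGo f (middle (x ∷ xs))))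
length-flashbackGo-step f x xs ℓ≢ with length (leadingRun (x ∷ xs)) ℕ.≟ length (x ∷ xs)
... | yes ℓ≡ = contradiction ℓ≡ ℓ≢
... | no _ with middle (x ∷ xs)
...   | []    = cong (suc ∘ length) (sym (flashbackGo-[] f))
...   | _ ∷ _ = refl

length-flashbackGo : ∀ f (span : List (Sym σ)) → length span ≤ f →
                     length (flashbackGo f span) ≡ ⌈ runs span /2⌉
length-flashbackGo f       []       _ = cong length (flashbackGo-[] f)
length-flashbackGo (suc f) (x ∷ xs) (s≤s len≤f) with outerRuns? x xs
... | singleRun x i = begin
  length (flashbackGo (suc f) (replicate (suc i) x))
    ≡⟨ cong length (flashbackGo-singleRun f x (replicate i x) (cong length (leadingRun-replicate x i))) ⟩
  1
    ≡⟨ cong ⌈_/2⌉ (runs-replicate x i) ⟨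
  ⌈ runs (replicate (suc i) x) /2⌉ ∎
  where open ≡-Reasoning
... | outerRuns {x} {z} i j mid ¬head ¬last = begin
  length (flashbackGo (suc f) span)
    ≡⟨ length-flashbackGo-step f x (replicate i x ++ mid ++ replicate (suc j) z)
                               (length-leadingRun-outer≢ i j mid ¬head ¬last) ⟩
  suc (length (flashbackGo f (middle span)))
    ≡⟨ cong (suc ∘ length ∘ flashbackGo f) (middle-outer i j mid ¬head ¬last) ⟩
  suc (length (flashbackGo f mid))
    ≡⟨ cong suc (length-flashbackGo f mid (≤-trans (length≤-infix (replicate i x) mid _) len≤f)) ⟩
  suc ⌈ runs mid /2⌉
    ≡⟨ cong ⌈_/2⌉ (runs-outer i j mid ¬head ¬last) ⟨
  ⌈ runs span /2⌉ ∎
  where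
  open ≡-Reasoning
  span = replicate (suc i) x ++ mid ++ replicate (suc j) z

head-map-chr-++-dollar≢at : ∀ (s : List (Fin σ)) → head (map chr s ++ dollar ∷ []) ≢ just at
head-map-chr-++-dollar≢at []      = λ ()
head-map-chr-++-dollar≢at (c ∷ s) = λ ()

last-at∷map-chr≢dollar : ∀ (s : List (Fin σ)) → last (at ∷ map chr s) ≢ just dollar
last-at∷map-chr≢dollar []          = λ ()
last-at∷map-chr≢dollar (c ∷ [])    = λ ()
last-at∷map-chr≢dollar (c ∷ d ∷ s) = last-at∷map-chr≢dollar (d ∷ s)

-- hat s is definitionally replicate 1 at ++ map chr s ++ replicate 1 dollar.
numTokens-runsOf : ∀ (s : List (Fin σ)) → numTokens s ≡ suc ⌈ runsOf s /2⌉
numTokens-runsOf s = begin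
  length (flashbackGo (length (hat s)) (hat s))
    ≡⟨ length-flashbackGo _ (hat s) ≤-refl ⟩
  ⌈ runs (hat s) /2⌉
    ≡⟨ cong ⌈_/2⌉ (runs-outer 0 0 (map chr s) (head-map-chr-++-dollar≢at s) (last-at∷map-chr≢dollar s)) ⟩
  suc ⌈ runsOf s /2⌉ ∎
  where open ≡-Reasoning

ℚ-ring : AlmostCommutativeRing _ _
ℚ-ring = fromCommutativeRing +-*-commutativeRing (λ x → dec⇒maybe (0ℚ ℚ.≟ x))

ℤtoℚ : ℤ → ℚ
ℤtoℚ i = i / 1

module _ where
  open ℚᵘP.≃-Reasoning

  toℚᵘ-ℤtoℚ : ∀ i → toℚᵘ (ℤtoℚ i) ℚᵘ.≃ mkℚᵘ i 0
  toℚᵘ-ℤtoℚ i = toℚᵘ-fromℚᵘ (mkℚᵘ i 0)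

  ℤtoℚ-+ : ∀ i j → ℤtoℚ (i ℤ.+ j) ≡ ℤtoℚ i + ℤtoℚ j
  ℤtoℚ-+ i j = toℚᵘ-injective (begin
    toℚᵘ (ℤtoℚ (i ℤ.+ j))            ≈⟨ toℚᵘ-ℤtoℚ (i ℤ.+ j) ⟩
    mkℚᵘ (i ℤ.+ j) 0                  ≈⟨ *≡* (cong₂ (λ x y → (x ℤ.+ y) ℤ.* + 1) (sym (ℤP.*-identityʳ i)) (sym (ℤP.*-identityʳ j))) ⟩
    mkℚᵘ i 0 ℚᵘ.+ mkℚᵘ j 0            ≈⟨ ℚᵘP.+-cong (toℚᵘ-ℤtoℚ i) (toℚᵘ-ℤtoℚ j) ⟨
    toℚᵘ (ℤtoℚ i) ℚᵘ.+ toℚᵘ (ℤtoℚ j)  ≈⟨ toℚᵘ-homo-+ (ℤtoℚ i) (ℤtoℚ j) ⟨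
    toℚᵘ (ℤtoℚ i + ℤtoℚ j)            ∎)

  ℤtoℚ-* : ∀ i j → ℤtoℚ (i ℤ.* j) ≡ ℤtoℚ i * ℤtoℚ j
  ℤtoℚ-* i j = toℚᵘ-injective (begin
    toℚᵘ (ℤtoℚ (i ℤ.* j))            ≈⟨ toℚᵘ-ℤtoℚ (i ℤ.* j) ⟩
    mkℚᵘ (i ℤ.* j) 0                  ≈⟨ ℚᵘP.*-cong (toℚᵘ-ℤtoℚ i) (toℚᵘ-ℤtoℚ j) ⟨
    toℚᵘ (ℤtoℚ i) ℚᵘ.* toℚᵘ (ℤtoℚ j)  ≈⟨ toℚᵘ-homo-* (ℤtoℚ i) (ℤtoℚ j) ⟨
    toℚᵘ (ℤtoℚ i * ℤtoℚ j)            ∎)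

  ℤtoℚ-neg : ∀ i → ℤtoℚ (ℤ.- i) ≡ - ℤtoℚ i
  ℤtoℚ-neg i = toℚᵘ-injective (begin
    toℚᵘ (ℤtoℚ (ℤ.- i))  ≈⟨ toℚᵘ-ℤtoℚ (ℤ.- i) ⟩
    mkℚᵘ (ℤ.- i) 0        ≈⟨ ℚᵘP.-‿cong (toℚᵘ-ℤtoℚ i) ⟨
    ℚᵘ.- toℚᵘ (ℤtoℚ i)    ≈⟨ toℚᵘ-homo‿- (ℤtoℚ i) ⟨
    toℚᵘ (- ℤtoℚ i)       ∎)

  ℕtoℚ-*-inverse : ∀ k → ℕtoℚ (suc k) * (+ 1 / suc k) ≡ 1ℚ
  ℕtoℚ-*-inverse k = toℚᵘ-injective (begin
    toℚᵘ (ℕtoℚ (suc k) * (+ 1 / suc k))          ≈⟨ toℚᵘ-homo-* (ℕtoℚ (suc k)) (+ 1 / suc k) ⟩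
    toℚᵘ (ℕtoℚ (suc k)) ℚᵘ.* toℚᵘ (+ 1 / suc k)  ≈⟨ ℚᵘP.*-cong (toℚᵘ-ℤtoℚ (+ suc k)) (toℚᵘ-fromℚᵘ (mkℚᵘ (+ 1) k)) ⟩
    mkℚᵘ (+ suc k) 0 ℚᵘ.* mkℚᵘ (+ 1) k           ≈⟨ ℚᵘP.*-inverseʳ (mkℚᵘ (+ suc k) 0) ⟩
    ℚᵘ.1ℚᵘ                                      ∎)

ℤtoℚ-- : ∀ i j → ℤtoℚ (i ℤ.- j) ≡ ℤtoℚ i - ℤtoℚ j
ℤtoℚ-- i j = trans (ℤtoℚ-+ i (ℤ.- j)) (cong (_+_ (ℤtoℚ i)) (ℤtoℚ-neg j))

ℕtoℚ-+ : ∀ m n → ℕtoℚ (m ℕ.+ n) ≡ ℕtoℚ m + ℕtoℚ n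
ℕtoℚ-+ m n = trans (cong ℤtoℚ (ℤP.pos-+ m n)) (ℤtoℚ-+ (+ m) (+ n))

ℕtoℚ-suc : ∀ n → ℕtoℚ (suc n) ≡ 1ℚ + ℕtoℚ n
ℕtoℚ-suc = ℕtoℚ-+ 1

ℕtoℚ-* : ∀ m n → ℕtoℚ (m ℕ.* n) ≡ ℕtoℚ m * ℕtoℚ n
ℕtoℚ-* m n = trans (cong ℤtoℚ (ℤP.pos-* m n)) (ℤtoℚ-* (+ m) (+ n))

÷ℕ-inverse : ∀ d x y → y * ℕtoℚ d ≡ 1ℚ → x ÷ℕ d ≡ x * y
÷ℕ-inverse zero    x y y*0≡1 = contradiction (trans (sym y*0≡1) (*-zeroʳ y)) 1≢0
÷ℕ-inverse (suc d) x y y*d≡1 = cong (x *_) (sym (begin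
  y              ≡⟨ *-identityʳ y ⟨
  y * 1ℚ         ≡⟨ cong (y *_) (ℕtoℚ-*-inverse d) ⟨
  y * (D * w)    ≡⟨ *-assoc y D w ⟨
  (y * D) * w    ≡⟨ cong (_* w) y*d≡1 ⟩
  1ℚ * w         ≡⟨ *-identityˡ w ⟩
  w              ∎))
  where
  open ≡-Reasoning
  w = + 1 / suc d
  D = ℕtoℚ (suc d)

^ℚ-+ : ∀ x m n → x ^ℚ (m ℕ.+ n) ≡ x ^ℚ m * x ^ℚ n
^ℚ-+ x zero    n = sym (*-identityˡ (x ^ℚ n))
^ℚ-+ x (suc m) n = trans (cong (x *_) (^ℚ-+ x m n)) (sym (*-assoc x (x ^ℚ m) (x ^ℚ n)))

^ℚ-double : ∀ x n → x ^ℚ (2 ℕ.* n) ≡ x ^ℚ n * x ^ℚ n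
^ℚ-double x n = trans (cong (λ e → x ^ℚ (n ℕ.+ e)) (+-identityʳ n)) (^ℚ-+ x n n)

∑ : List A → (A → ℚ) → ℚ
∑ xs f = sumℚ (map f xs)

module _ {f g : A → ℚ} where

  ∑-cong : (∀ x → f x ≡ g x) → ∀ xs → ∑ xs f ≡ ∑ xs g
  ∑-cong f≗g []       = refl
  ∑-cong f≗g (x ∷ xs) = cong₂ _+_ (f≗g x) (∑-cong f≗g xs)

  ∑-+ : ∀ xs → ∑ xs (λ x → f x + g x) ≡ ∑ xs f + ∑ xs g
  ∑-+ []       = refl
  ∑-+ (x ∷ xs) = trans (cong (_+_ (f x + g x)) (∑-+ xs)) (interchange (f x) (g x) (∑ xs f) (∑ xs g))
    where
    interchange : ∀ a b c d → a + b + (c + d) ≡ a + c + (b + d)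
    interchange = solve-∀ ℚ-ring

∑-*ˡ : ∀ c (f : A → ℚ) xs → ∑ xs (λ x → c * f x) ≡ c * ∑ xs f
∑-*ˡ c f []       = sym (*-zeroʳ c)
∑-*ˡ c f (x ∷ xs) = trans (cong (_+_ (c * f x)) (∑-*ˡ c f xs)) (sym (*-distribˡ-+ c (f x) (∑ xs f)))

∑-++ : ∀ (f : A → ℚ) xs ys → ∑ (xs ++ ys) f ≡ ∑ xs f + ∑ ys f
∑-++ f []       ys = sym (+-identityˡ (∑ ys f))
∑-++ f (x ∷ xs) ys = trans (cong (_+_ (f x)) (∑-++ f xs ys)) (sym (+-assoc (f x) (∑ xs f) (∑ ys f)))

∑-concatMap : ∀ {B : Set} (f : B → ℚ) (h : A → List B) xs →
              ∑ (concatMap h xs) f ≡ ∑ xs (λ x → ∑ (h x) f)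
∑-concatMap f h []       = refl
∑-concatMap f h (x ∷ xs) =
  trans (∑-++ f (h x) (concatMap h xs)) (cong (_+_ (∑ (h x) f)) (∑-concatMap f h xs))

∑-allFin-suc : ∀ n (f : Fin (suc n) → ℚ) → ∑ (allFin (suc n)) f ≡ f Fin.zero + ∑ (allFin n) (f ∘ Fin.suc)
∑-allFin-suc n f =
  cong (λ s → f Fin.zero + sumℚ s) (trans (map-tabulate Fin.suc f) (sym (map-tabulate id (f ∘ Fin.suc))))

∑-allFin-const : ∀ n (f : Fin n → ℚ) {b} → (∀ c → f c ≡ b) → ∑ (allFin n) f ≡ ℕtoℚ n * b
∑-allFin-const zero    f {b} _   = sym (*-zeroˡ b)
∑-allFin-const (suc n) f {b} f≡b = begin
  ∑ (allFin (suc n)) f                      ≡⟨ ∑-allFin-suc n f ⟩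
  f Fin.zero + ∑ (allFin n) (f ∘ Fin.suc)   ≡⟨ cong₂ _+_ (f≡b Fin.zero) (∑-allFin-const n (f ∘ Fin.suc) (f≡b ∘ Fin.suc)) ⟩
  b + ℕtoℚ n * b                            ≡⟨ cong (_+ ℕtoℚ n * b) (*-identityˡ b) ⟨
  1ℚ * b + ℕtoℚ n * b                       ≡⟨ *-distribʳ-+ b 1ℚ (ℕtoℚ n) ⟨
  (1ℚ + ℕtoℚ n) * b                         ≡⟨ cong (_* b) (ℕtoℚ-suc n) ⟨
  ℕtoℚ (suc n) * b                          ∎
  where open ≡-Reasoning

∑-allFin-except : ∀ n (f : Fin (suc n) → ℚ) d {b} → (∀ c → c ≢ d → f c ≡ b) →
                  ∑ (allFin (suc n)) f ≡ f d + ℕtoℚ n * b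
∑-allFin-except n f Fin.zero f≡b =
  trans (∑-allFin-suc n f) (cong (_+_ (f Fin.zero)) (∑-allFin-const n (f ∘ Fin.suc) (λ c → f≡b (Fin.suc c) λ ())))
∑-allFin-except (suc n) f (Fin.suc d) {b} f≡b = begin
  ∑ (allFin (suc (suc n))) f
    ≡⟨ ∑-allFin-suc (suc n) f ⟩
  f Fin.zero + ∑ (allFin (suc n)) (f ∘ Fin.suc)
    ≡⟨ cong₂ _+_ (f≡b Fin.zero λ ()) (∑-allFin-except n (f ∘ Fin.suc) d (λ c c≢d → f≡b (Fin.suc c) (c≢d ∘ suc-injective))) ⟩
  b + (f (Fin.suc d) + ℕtoℚ n * b)
    ≡⟨ rearrange b (f (Fin.suc d)) (ℕtoℚ n) ⟩
  f (Fin.suc d) + (1ℚ + ℕtoℚ n) * b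
    ≡⟨ cong (λ N → f (Fin.suc d) + N * b) (ℕtoℚ-suc n) ⟨
  f (Fin.suc d) + ℕtoℚ (suc n) * b ∎
  where
  open ≡-Reasoning
  rearrange : ∀ b x N → b + (x + N * b) ≡ x + (1ℚ + N) * b
  rearrange = solve-∀ ℚ-ring

∑-allStrings-suc : ∀ σ n (F : List (Fin σ) → ℚ) →
                   ∑ (allStrings σ (suc n)) F ≡ ∑ (allStrings σ n) (λ s → ∑ (allFin σ) (λ c → F (c ∷ s)))
∑-allStrings-suc σ n F = trans (∑-concatMap F (λ s → map (_∷ s) (allFin σ)) (allStrings σ n))
                               (∑-cong (λ s → cong sumℚ (sym (map-∘ (allFin σ)))) (allStrings σ n))

∑-allStrings-suc-cong : ∀ σ n {F G : List (Fin σ) → ℚ} → (∀ c s → F (c ∷ s) ≡ G (c ∷ s)) →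
                        ∑ (allStrings σ (suc n)) F ≡ ∑ (allStrings σ (suc n)) G
∑-allStrings-suc-cong σ n {F} {G} F≗G = begin
  ∑ (allStrings σ (suc n)) F                                  ≡⟨ ∑-allStrings-suc σ n F ⟩
  ∑ (allStrings σ n) (λ s → ∑ (allFin σ) (λ c → F (c ∷ s)))   ≡⟨ ∑-cong (λ s → ∑-cong (λ c → F≗G c s) (allFin σ)) (allStrings σ n) ⟩
  ∑ (allStrings σ n) (λ s → ∑ (allFin σ) (λ c → G (c ∷ s)))   ≡⟨ ∑-allStrings-suc σ n G ⟨
  ∑ (allStrings σ (suc n)) G                                  ∎
  where open ≡-Reasoning

expect-cong : ∀ σ n {F G : List (Fin σ) → ℚ} → (∀ s → F s ≡ G s) → expect σ n F ≡ expect σ n G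
expect-cong σ n F≗G = cong (_÷ℕ (σ ℕ.^ n)) (∑-cong F≗G (allStrings σ n))

-- Binomial expectations

-- E g(X) for X ~ Bin(m, p), by conditioning on the first trial.
binomialExpect : ℚ → (ℕ → ℚ) → ℕ → ℚ
binomialExpect p g zero    = g 0
binomialExpect p g (suc m) = (1ℚ - p) * binomialExpect p g m + p * binomialExpect p (g ∘ suc) m

binomialExpect-cong : ∀ p {f g : ℕ → ℚ} → (∀ i → f i ≡ g i) → ∀ m → binomialExpect p f m ≡ binomialExpect p g m
binomialExpect-cong p f≗g zero    = f≗g 0
binomialExpect-cong p f≗g (suc m) =
  cong₂ (λ x y → (1ℚ - p) * x + p * y) (binomialExpect-cong p f≗g m) (binomialExpect-cong p (f≗g ∘ suc) m)

record QuasiQuadratic : Set where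
  constructor quasi
  field a b c d e : ℚ

sign : ℕ → ℚ
sign i = (- 1ℚ) ^ℚ i

⟦_⟧ : QuasiQuadratic → ℕ → ℚ
⟦ quasi a b c d e ⟧ i = a + b * ℕtoℚ i + c * (ℕtoℚ i * ℕtoℚ i) + sign i * (d + e * ℕtoℚ i)

shift : QuasiQuadratic → QuasiQuadratic
shift (quasi a b c d e) = quasi (a + b + c) (b + (c + c)) c (- (d + e)) (- e)

⟦⟧-suc : ∀ f i → ⟦ f ⟧ (suc i) ≡ ⟦ shift f ⟧ i
⟦⟧-suc (quasi a b c d e) i =
  trans (cong (λ I → a + b * I + c * (I * I) + - 1ℚ * sign i * (d + e * I)) (ℕtoℚ-suc i))
        (expand a b c d e (ℕtoℚ i) (sign i))
  where
  expand : ∀ a b c d e I s →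
           a + b * (1ℚ + I) + c * ((1ℚ + I) * (1ℚ + I)) + - 1ℚ * s * (d + e * (1ℚ + I))
           ≡ a + b + c + (b + (c + c)) * I + c * (I * I) + s * (- (d + e) + - e * I)
  expand = solve-∀ ℚ-ring

-- The terms are the moments E X = mp, E X² = mp + m(m − 1)p², E (−1)^X = (1 − 2p)^m and
-- E X(−1)^X = −mp(1 − 2p)^(m − 1) of X ~ Bin(m, p), with Q standing for (1 − 2p)^(m − 1).
binomialMean : ℚ → QuasiQuadratic → (m Q : ℚ) → ℚ
binomialMean p (quasi a b c d e) m Q =
  a + b * (m * p) + c * (m * p + m * (m - 1ℚ) * (p * p)) + d * ((1ℚ - (p + p)) * Q) - e * (m * p * Q)

binomialExpect-quasi : ∀ p f j →
  binomialExpect p ⟦ f ⟧ (suc j) ≡ binomialMean p f (ℕtoℚ (suc j)) ((1ℚ - (p + p)) ^ℚ j)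
binomialExpect-quasi p f@(quasi a b c d e) zero =
  trans (cong (λ x → (1ℚ - p) * ⟦ f ⟧ 0 + p * x) (⟦⟧-suc f 0)) (base p a b c d e)
  where
  base : ∀ p a b c d e →
    (1ℚ - p) * (a + b * 0ℚ + c * (0ℚ * 0ℚ) + 1ℚ * (d + e * 0ℚ))
    + p * (a + b + c + (b + (c + c)) * 0ℚ + c * (0ℚ * 0ℚ) + 1ℚ * (- (d + e) + - e * 0ℚ))
    ≡ a + b * (1ℚ * p) + c * (1ℚ * p + 1ℚ * (1ℚ - 1ℚ) * (p * p)) + d * ((1ℚ - (p + p)) * 1ℚ) - e * (1ℚ * p * 1ℚ)
  base = solve-∀ ℚ-ring
binomialExpect-quasi p f@(quasi a b c d e) (suc j) = begin
  (1ℚ - p) * binomialExpect p ⟦ f ⟧ (suc j) + p * binomialExpect p (⟦ f ⟧ ∘ suc) (suc j)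
    ≡⟨ cong₂ (λ x y → (1ℚ - p) * x + p * y) (binomialExpect-quasi p f j)
             (trans (binomialExpect-cong p (⟦⟧-suc f) (suc j)) (binomialExpect-quasi p (shift f) j)) ⟩
  (1ℚ - p) * binomialMean p f m Q + p * binomialMean p (shift f) m Q
    ≡⟨ step p a b c d e m Q ⟩
  binomialMean p f (1ℚ + m) ((1ℚ - (p + p)) * Q)
    ≡⟨ cong (λ m′ → binomialMean p f m′ ((1ℚ - (p + p)) * Q)) (ℕtoℚ-suc (suc j)) ⟨
  binomialMean p f (ℕtoℚ (suc (suc j))) ((1ℚ - (p + p)) ^ℚ suc j) ∎
  where
  open ≡-Reasoning
  m = ℕtoℚ (suc j)
  Q = (1ℚ - (p + p)) ^ℚ j
  step : ∀ p a b c d e m Q →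
    (1ℚ - p) * (a + b * (m * p) + c * (m * p + m * (m - 1ℚ) * (p * p)) + d * ((1ℚ - (p + p)) * Q) - e * (m * p * Q))
    + p * (a + b + c + (b + (c + c)) * (m * p) + c * (m * p + m * (m - 1ℚ) * (p * p))
           + - (d + e) * ((1ℚ - (p + p)) * Q) - - e * (m * p * Q))
    ≡ a + b * ((1ℚ + m) * p) + c * ((1ℚ + m) * p + (1ℚ + m) * ((1ℚ + m) - 1ℚ) * (p * p))
      + d * ((1ℚ - (p + p)) * ((1ℚ - (p + p)) * Q)) - e * ((1ℚ + m) * p * ((1ℚ - (p + p)) * Q))
  step = solve-∀ ℚ-ring

-- Uniform strings

module UniformString (k : ℕ) where

  u p : ℚ
  u = + 1 / suc k
  p = ℕtoℚ k * u

  σ*u≡1 : ℕtoℚ (suc k) * u ≡ 1ℚ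
  σ*u≡1 = ℕtoℚ-*-inverse k

  1-p≡u : 1ℚ - p ≡ u
  1-p≡u = begin
    1ℚ - ℕtoℚ k * u                 ≡⟨ cong (_- p) σ*u≡1 ⟨
    ℕtoℚ (suc k) * u - ℕtoℚ k * u   ≡⟨ cong (λ S → S * u - p) (ℕtoℚ-suc k) ⟩
    (1ℚ + ℕtoℚ k) * u - ℕtoℚ k * u  ≡⟨ cancel (ℕtoℚ k) u ⟩
    u                               ∎
    where
    open ≡-Reasoning
    cancel : ∀ K u → (1ℚ + K) * u - K * u ≡ u
    cancel = solve-∀ ℚ-ring

  q≡1-2p : ((+ 2 -ℤ + suc k) / 1) ÷ℕ suc k ≡ 1ℚ - (p + p)
  q≡1-2p = begin
    ℤtoℚ (+ 2 -ℤ + suc k) * u         ≡⟨ cong (_* u) (ℤtoℚ-- (+ 2) (+ suc k)) ⟩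
    (ℤtoℚ (+ 2) - ℕtoℚ (suc k)) * u   ≡⟨ cong (λ S → (ℤtoℚ (+ 2) - S) * u) (ℕtoℚ-suc k) ⟩
    (ℤtoℚ (+ 2) - (1ℚ + ℕtoℚ k)) * u  ≡⟨ expand (ℕtoℚ k) u ⟩
    (1ℚ + ℕtoℚ k) * u - (p + p)       ≡⟨ cong (λ S → S * u - (p + p)) (ℕtoℚ-suc k) ⟨
    ℕtoℚ (suc k) * u - (p + p)        ≡⟨ cong (_- (p + p)) σ*u≡1 ⟩
    1ℚ - (p + p)                      ∎
    where
    open ≡-Reasoning
    expand : ∀ K u → (+ 2 / 1 - (1ℚ + K)) * u ≡ (1ℚ + K) * u - (K * u + K * u)
    expand = solve-∀ ℚ-ring

  u^n*σ^n≡1 : ∀ n → u ^ℚ n * ℕtoℚ (suc k ℕ.^ n) ≡ 1ℚ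
  u^n*σ^n≡1 zero    = refl
  u^n*σ^n≡1 (suc n) = begin
    u * u ^ℚ n * ℕtoℚ (suc k ℕ.* suc k ℕ.^ n)         ≡⟨ cong (u * u ^ℚ n *_) (ℕtoℚ-* (suc k) (suc k ℕ.^ n)) ⟩
    u * u ^ℚ n * (ℕtoℚ (suc k) * ℕtoℚ (suc k ℕ.^ n))  ≡⟨ interchange u (u ^ℚ n) (ℕtoℚ (suc k)) (ℕtoℚ (suc k ℕ.^ n)) ⟩
    ℕtoℚ (suc k) * u * (u ^ℚ n * ℕtoℚ (suc k ℕ.^ n))  ≡⟨ cong₂ _*_ σ*u≡1 (u^n*σ^n≡1 n) ⟩
    1ℚ * 1ℚ                                           ∎
    where
    open ≡-Reasoning
    interchange : ∀ a b c d → a * b * (c * d) ≡ c * a * (b * d)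
    interchange = solve-∀ ℚ-ring

  expect-as-∑ : ∀ n (F : List (Fin (suc k)) → ℚ) → expect (suc k) n F ≡ ∑ (allStrings (suc k) n) F * u ^ℚ n
  expect-as-∑ n F = ÷ℕ-inverse (suc k ℕ.^ n) _ (u ^ℚ n) (u^n*σ^n≡1 n)

  ∑-runsOf-∷ : ∀ (g : ℕ → ℚ) d t →
               ∑ (allFin (suc k)) (λ c → g (runsOf (c ∷ d ∷ t))) ≡ g (runsOf (d ∷ t)) + ℕtoℚ k * g (suc (runsOf (d ∷ t)))
  ∑-runsOf-∷ g d t =
    trans (∑-allFin-except k _ d (λ c c≢d → cong g (runs-∷-≢ (map chr t) (c≢d ∘ chr-injective))))
          (cong (λ r → g r + ℕtoℚ k * g (suc (runsOf (d ∷ t)))) (runs-∷-≡ (chr d) (map chr t)))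
    where
    chr-injective : ∀ {c d : Fin (suc k)} → chr c ≡ chr d → c ≡ d
    chr-injective refl = refl

  ∑-runsOf-suc : ∀ m (g : ℕ → ℚ) →
                 ∑ (allStrings (suc k) (suc (suc m))) (g ∘ runsOf)
                 ≡ ∑ (allStrings (suc k) (suc m)) (g ∘ runsOf) + ℕtoℚ k * ∑ (allStrings (suc k) (suc m)) (g ∘ suc ∘ runsOf)
  ∑-runsOf-suc m g = begin
    ∑ (allStrings (suc k) (suc (suc m))) (g ∘ runsOf)
      ≡⟨ ∑-allStrings-suc (suc k) (suc m) (g ∘ runsOf) ⟩
    ∑ strings (λ s → ∑ (allFin (suc k)) (λ c → g (runsOf (c ∷ s))))
      ≡⟨ ∑-allStrings-suc-cong (suc k) m (∑-runsOf-∷ g) ⟩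
    ∑ strings (λ s → g (runsOf s) + ℕtoℚ k * g (suc (runsOf s)))
      ≡⟨ ∑-+ strings ⟩
    ∑ strings (g ∘ runsOf) + ∑ strings (λ s → ℕtoℚ k * g (suc (runsOf s)))
      ≡⟨ cong (_+_ (∑ strings (g ∘ runsOf))) (∑-*ˡ (ℕtoℚ k) (g ∘ suc ∘ runsOf) strings) ⟩
    ∑ strings (g ∘ runsOf) + ℕtoℚ k * ∑ strings (g ∘ suc ∘ runsOf) ∎
    where
    open ≡-Reasoning
    strings = allStrings (suc k) (suc m)

  expect-runsOf-suc : ∀ m (g : ℕ → ℚ) →
                      expect (suc k) (suc (suc m)) (g ∘ runsOf)
                      ≡ (1ℚ - p) * expect (suc k) (suc m) (g ∘ runsOf) + p * expect (suc k) (suc m) (g ∘ suc ∘ runsOf)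
  expect-runsOf-suc m g = begin
    expect (suc k) (suc (suc m)) (g ∘ runsOf)
      ≡⟨ expect-as-∑ (suc (suc m)) (g ∘ runsOf) ⟩
    ∑ (allStrings (suc k) (suc (suc m))) (g ∘ runsOf) * (u * U)
      ≡⟨ cong (_* (u * U)) (∑-runsOf-suc m g) ⟩
    (X + ℕtoℚ k * Y) * (u * U)
      ≡⟨ distribute X Y (ℕtoℚ k) u U ⟩
    u * (X * U) + p * (Y * U)
      ≡⟨ cong₂ (λ v w → v * (X * U) + p * w) (sym 1-p≡u) (sym (expect-as-∑ (suc m) (g ∘ suc ∘ runsOf))) ⟩
    (1ℚ - p) * (X * U) + p * expect (suc k) (suc m) (g ∘ suc ∘ runsOf)
      ≡⟨ cong (λ e → (1ℚ - p) * e + p * expect (suc k) (suc m) (g ∘ suc ∘ runsOf)) (expect-as-∑ (suc m) (g ∘ runsOf)) ⟨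
    (1ℚ - p) * expect (suc k) (suc m) (g ∘ runsOf) + p * expect (suc k) (suc m) (g ∘ suc ∘ runsOf) ∎
    where
    open ≡-Reasoning
    U = u ^ℚ suc m
    X = ∑ (allStrings (suc k) (suc m)) (g ∘ runsOf)
    Y = ∑ (allStrings (suc k) (suc m)) (g ∘ suc ∘ runsOf)
    distribute : ∀ X Y K u U → (X + K * Y) * (u * U) ≡ u * (X * U) + K * u * (Y * U)
    distribute = solve-∀ ℚ-ring

  expect-runsOf : ∀ m (g : ℕ → ℚ) → expect (suc k) (suc m) (g ∘ runsOf) ≡ binomialExpect p (g ∘ suc) m
  expect-runsOf zero g = begin
    expect (suc k) 1 (g ∘ runsOf)
      ≡⟨ expect-as-∑ 1 (g ∘ runsOf) ⟩
    ∑ (allStrings (suc k) 1) (g ∘ runsOf) * (u * 1ℚ)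
      ≡⟨ cong (_* (u * 1ℚ)) (trans (∑-allStrings-suc (suc k) 0 (g ∘ runsOf))
                                   (cong (_+ 0ℚ) (∑-allFin-const (suc k) _ (λ _ → refl)))) ⟩
    (ℕtoℚ (suc k) * g 1 + 0ℚ) * (u * 1ℚ)
      ≡⟨ rearrange (ℕtoℚ (suc k)) (g 1) u ⟩
    ℕtoℚ (suc k) * u * g 1
      ≡⟨ cong (_* g 1) σ*u≡1 ⟩
    1ℚ * g 1
      ≡⟨ *-identityˡ (g 1) ⟩
    g 1 ∎
    where
    open ≡-Reasoning
    rearrange : ∀ S x u → (S * x + 0ℚ) * (u * 1ℚ) ≡ S * u * x
    rearrange = solve-∀ ℚ-ring
  expect-runsOf (suc m) g = trans (expect-runsOf-suc m g)
    (cong₂ (λ x y → (1ℚ - p) * x + p * y) (expect-runsOf m g) (expect-runsOf m (g ∘ suc)))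

sign-square : ∀ i → sign i * sign i ≡ 1ℚ
sign-square zero    = refl
sign-square (suc i) = trans (negate² (sign i)) (sign-square i)
  where
  negate² : ∀ s → - 1ℚ * s * (- 1ℚ * s) ≡ s * s
  negate² = solve-∀ ℚ-ring

tokens tokens² : QuasiQuadratic
tokens  = quasi (+ 7 / 4) ½ 0ℚ (+ 1 / 4) 0ℚ
tokens² = quasi (+ 25 / 8) (+ 7 / 4) (+ 1 / 4) (+ 7 / 8) (+ 1 / 4)

tokens-quasi : ∀ b → ℕtoℚ (2 ℕ.+ ⌊ b /2⌋) ≡ ⟦ tokens ⟧ b
tokens-quasi zero          = refl
tokens-quasi (suc zero)    = refl
tokens-quasi (suc (suc b)) = begin
  ℕtoℚ (suc (2 ℕ.+ ⌊ b /2⌋))  ≡⟨ ℕtoℚ-suc (2 ℕ.+ ⌊ b /2⌋) ⟩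
  1ℚ + ℕtoℚ (2 ℕ.+ ⌊ b /2⌋)   ≡⟨ cong (_+_ 1ℚ) (tokens-quasi b) ⟩
  1ℚ + ⟦ tokens ⟧ b           ≡⟨ one+ (ℕtoℚ b) (sign b) ⟩
  ⟦ shift (shift tokens) ⟧ b  ≡⟨ trans (⟦⟧-suc tokens (suc b)) (⟦⟧-suc (shift tokens) b) ⟨
  ⟦ tokens ⟧ (suc (suc b))    ∎
  where
  open ≡-Reasoning
  one+ : ∀ I s → 1ℚ + (+ 7 / 4 + ½ * I + 0ℚ * (I * I) + s * (+ 1 / 4 + 0ℚ * I))
                 ≡ + 11 / 4 + ½ * I + 0ℚ * (I * I) + s * (+ 1 / 4 + 0ℚ * I)
  one+ = solve-∀ ℚ-ring

tokens²-quasi : ∀ b → ℕtoℚ (2 ℕ.+ ⌊ b /2⌋) * ℕtoℚ (2 ℕ.+ ⌊ b /2⌋) ≡ ⟦ tokens² ⟧ b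
tokens²-quasi b = begin
  ℕtoℚ (2 ℕ.+ ⌊ b /2⌋) * ℕtoℚ (2 ℕ.+ ⌊ b /2⌋)
    ≡⟨ cong₂ _*_ (tokens-quasi b) (tokens-quasi b) ⟩
  ⟦ tokens ⟧ b * ⟦ tokens ⟧ b
    ≡⟨ square (ℕtoℚ b) (sign b) ⟩
  + 49 / 16 + sign b * sign b * (+ 1 / 16) + + 7 / 4 * I + + 1 / 4 * (I * I) + sign b * (+ 7 / 8 + + 1 / 4 * I)
    ≡⟨ cong (λ s² → + 49 / 16 + s² * (+ 1 / 16) + + 7 / 4 * I + + 1 / 4 * (I * I) + sign b * (+ 7 / 8 + + 1 / 4 * I))
            (sign-square b) ⟩
  ⟦ tokens² ⟧ b ∎
  where
  open ≡-Reasoning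
  I = ℕtoℚ b
  square : ∀ I s → (+ 7 / 4 + ½ * I + 0ℚ * (I * I) + s * (+ 1 / 4 + 0ℚ * I))
                   * (+ 7 / 4 + ½ * I + 0ℚ * (I * I) + s * (+ 1 / 4 + 0ℚ * I))
                   ≡ + 49 / 16 + s * s * (+ 1 / 16) + + 7 / 4 * I + + 1 / 4 * (I * I) + s * (+ 7 / 8 + + 1 / 4 * I)
  square = solve-∀ ℚ-ring

expect-tokens : ∀ k j (h : ℚ → ℚ) f → (∀ b → h (ℕtoℚ (2 ℕ.+ ⌊ b /2⌋)) ≡ ⟦ f ⟧ b) →
                let open UniformString k in
                expect (suc k) (suc (suc j)) (λ s → h (ℕtoℚ (numTokens s)))
                ≡ binomialMean p f (ℕtoℚ (suc j)) ((1ℚ - (p + p)) ^ℚ j)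
expect-tokens k j h f h≗f = begin
  expect (suc k) (suc (suc j)) (λ s → h (ℕtoℚ (numTokens s)))
    ≡⟨ expect-cong (suc k) (suc (suc j)) (λ s → cong (h ∘ ℕtoℚ) (numTokens-runsOf s)) ⟩
  expect (suc k) (suc (suc j)) ((λ r → h (ℕtoℚ (suc ⌈ r /2⌉))) ∘ runsOf)
    ≡⟨ expect-runsOf (suc j) (λ r → h (ℕtoℚ (suc ⌈ r /2⌉))) ⟩
  binomialExpect p (λ b → h (ℕtoℚ (2 ℕ.+ ⌊ b /2⌋))) (suc j)
    ≡⟨ binomialExpect-cong p h≗f (suc j) ⟩
  binomialExpect p ⟦ f ⟧ (suc j)
    ≡⟨ binomialExpect-quasi p f j ⟩
  binomialMean p f (ℕtoℚ (suc j)) ((1ℚ - (p + p)) ^ℚ j) ∎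
  where
  open ≡-Reasoning
  open UniformString k

-- The left-hand side is binomialMean p tokens² m Q − (binomialMean p tokens m Q)², unfolded for the solver.
variance-identity : ∀ p m Q →
  (+ 25 / 8 + + 7 / 4 * (m * p) + + 1 / 4 * (m * p + m * (m - 1ℚ) * (p * p)) + + 7 / 8 * ((1ℚ - (p + p)) * Q) - + 1 / 4 * (m * p * Q))
  - (+ 7 / 4 + ½ * (m * p) + 0ℚ * (m * p + m * (m - 1ℚ) * (p * p)) + + 1 / 4 * ((1ℚ - (p + p)) * Q) - 0ℚ * (m * p * Q))
    * (+ 7 / 4 + ½ * (m * p) + 0ℚ * (m * p + m * (m - 1ℚ) * (p * p)) + + 1 / 4 * ((1ℚ - (p + p)) * Q) - 0ℚ * (m * p * Q))
  ≡ m * p * (1ℚ - p) * (+ 1 / 4) - m * p * (1ℚ - p) * Q * (+ 1 / 2)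
    + (1ℚ - (1ℚ - (p + p)) * Q * ((1ℚ - (p + p)) * Q)) * (+ 1 / 16)
variance-identity = solve-∀ ℚ-ring

mainTheorem14 : (n σ : ℕ) → 2 ≤ n → 2 ≤ σ →
  let p = (((+ σ) -ℤ (+ 1)) / 1) ÷ℕ σ
      m = n ∸ 1
      q = (((+ 2) -ℤ (+ σ)) / 1) ÷ℕ σ
      mℚ = ℕtoℚ m
  in variance σ n (λ s → ℕtoℚ (numTokens s))
     ≡ ((((mℚ * p) * (1ℚ - p)) ÷ℕ 4)
        - ((((mℚ * p) * (1ℚ - p)) * (q ^ℚ (m ∸ 1))) ÷ℕ 2))
       + ((1ℚ - (q ^ℚ (2 Data.Nat.* m))) ÷ℕ 16)
mainTheorem14 (suc (suc j)) (suc k) (s≤s (s≤s _)) (s≤s _) = begin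
  variance (suc k) (suc (suc j)) (λ s → ℕtoℚ (numTokens s))
    ≡⟨ cong₂ (λ E₂ E₁ → E₂ - E₁ * E₁) (expect-tokens k j (λ x → x * x) tokens² tokens²-quasi)
                                      (expect-tokens k j id tokens tokens-quasi) ⟩
  binomialMean p tokens² M Q - binomialMean p tokens M Q * binomialMean p tokens M Q
    ≡⟨ variance-identity p M Q ⟩
  RHS q (q ^ℚ suc j * q ^ℚ suc j)
    ≡⟨ cong (RHS q) (^ℚ-double q (suc j)) ⟨
  RHS q (q ^ℚ (2 ℕ.* suc j))
    ≡⟨ cong (λ q′ → RHS q′ (q′ ^ℚ (2 ℕ.* suc j))) q≡1-2p ⟨
  RHS q′ (q′ ^ℚ (2 ℕ.* suc j)) ∎
  where
  open ≡-Reasoning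
  open UniformString k
  M = ℕtoℚ (suc j)
  q = 1ℚ - (p + p)
  q′ = ((+ 2 -ℤ + suc k) / 1) ÷ℕ suc k
  Q = q ^ℚ j
  RHS : ℚ → ℚ → ℚ
  RHS r r²ᵐ = ((M * p * (1ℚ - p)) ÷ℕ 4 - (M * p * (1ℚ - p) * r ^ℚ j) ÷ℕ 2) + (1ℚ - r²ᵐ) ÷ℕ 16
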